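{- For every $n\geq 3$, the independence system $(C_n)_{\mathrm{res}}$ on the vertex set of the cycle graph $C_n$, whose independent sets are the subsets of minimal resolving sets of $C_n$, is a matroid.
   Context: $C_n$ is the cycle on $n$ vertices. For a connected graph $G$, $d(u,w)$ is the shortest-path distance; $R\subseteq V(G)$ is a resolving set if for any two distinct vertices $u,w$ there is $h\in R$ with $d(u,h)\ne d(w,h)$, and it is minimal if no proper subset of it is resolving. A matroid is an independence system such that for any independent sets $A,B$ with $|A|<|B|$ there is $x\in B\setminus A$ with $A\cup\{x\}$ independent. -}

module Defs where

open import Data.Nat using (ℕ; zero; suc; _<_)
open import Data.Fin using (Fin; toℕ)
open import Data.Fin.Subset using (Subset; _∈_; _∉_; _⊆_; _⊂_; ∣_∣; ⊥; _∪_; ⁅_⁆)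
open import Data.Product using (Σ; ∃; ∃-syntax; _×_; _,_)
open import Data.Sum using (_⊎_)
open import Relation.Binary.PropositionalEquality using (_≡_; _≢_)
open import Relation.Nullary using (¬_)

Graph : ℕ → Set₁
Graph n = Fin n → Fin n → Set

CycleAdj : (n : ℕ) → Fin n → Fin n → Set
CycleAdj n i j = (suc (toℕ i) ≡ toℕ j) ⊎ (suc (toℕ j) ≡ toℕ i)
               ⊎ ((suc (toℕ i) ≡ n) × (toℕ j ≡ 0))
               ⊎ ((suc (toℕ j) ≡ n) × (toℕ i ≡ 0))

C : (n : ℕ) → Graph n
C n = CycleAdj n

data Walk {n : ℕ} (G : Graph n) : Fin n → Fin n → ℕ → Set where
  here : ∀ {u} → Walk G u u zero
  step : ∀ {u v w k} → G u v → Walk G v w k → Walk G u w (suc k)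

Dist : {n : ℕ} → Graph n → Fin n → Fin n → ℕ → Set
Dist G u w k = Walk G u w k × (∀ m → m < k → ¬ Walk G u w m)

Resolving : {n : ℕ} → Graph n → Subset n → Set
Resolving {n} G R = ∀ (u w : Fin n) → u ≢ w →
  ∃[ h ] (h ∈ R × ∃[ a ] ∃[ b ] (Dist G u h a × Dist G w h b × a ≢ b))

MinimalResolving : {n : ℕ} → Graph n → Subset n → Set
MinimalResolving G R = Resolving G R × (∀ S → S ⊂ R → ¬ Resolving G S)

ResIndep : {n : ℕ} → Graph n → Subset n → Set
ResIndep G A = ∃[ R ] (MinimalResolving G R × A ⊆ R)

record IsMatroid {n : ℕ} (I : Subset n → Set) : Set where
  field
    empty-indep : I ⊥
    down-closed : ∀ {A B} → A ⊆ B → I B → I A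
    exchange    : ∀ {A B} → I A → I B → ∣ A ∣ < ∣ B ∣ →
                  ∃[ x ] (x ∈ B × x ∉ A × I (A ∪ ⁅ x ⁆))

-- On C n the distance from u to h is the least k with k + u ≡ h or k + h ≡ u (mod n), so two
-- vertices at the same distance from h are equal or satisfy u + w ≡ 2h (mod n).  Hence {a, b}
-- resolves C n unless 2a ≡ 2b, i.e. unless a and b are equal or antipodal, while no single
-- vertex c resolves it (the two neighbours of c are both at distance 1 from c).  A vertex has at
-- most one antipode, so any three vertices contain a resolving pair: the minimal resolving sets
-- are exactly the non-antipodal pairs, independent sets have at most two elements, and exchange
-- comes down to finding, for a vertex a and distinct b₁, b₂ in a minimal resolving set, some
-- bᵢ ≠ a with {a, bᵢ} independent.

module Submission where

open import Defs
open import Data.Nat using (ℕ; zero; suc; pred; _+_; _*_; _∸_; _≤_; _<_; _≥_; _≟_; _<?_; z≤n; s≤s; s≤s⁻¹; NonZero; >-nonZero⁻¹)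
open import Data.Nat.Properties
open import Data.Nat.DivMod using (_%_; _mod_; m%n<n; %-distribˡ-+; [m+kn]%n≡m%n; [m+n]%n≡m%n; m<n⇒m%n≡m; n%n≡0; m%n%n≡m%n)
open import Data.Fin using (Fin; toℕ) renaming (_≟_ to _≟ᶠ_)
import Data.Fin as Fin
open import Data.Fin.Properties using (toℕ-injective; toℕ<n; toℕ-fromℕ<)
open import Data.Fin.Subset using (Subset; _∈_; _∉_; _⊆_; _⊂_; ∣_∣; _∪_; ⁅_⁆; _─_; _-_; inside; outside)
open import Data.Fin.Subset.Properties
  using (x∈⁅x⁆; x∈⁅y⁆⇒x≡y; x∈p∪q⁺; x∈p∪q⁻; p⊆p∪q; q⊆p∪q; ⊆-refl; ⊥⊆; nonempty?; Empty-unique; ∣⊥∣≡0; x∈p∧x≢y⇒x∈p-y; p─q⊆p; p─⊥≡p)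
open import Data.Vec.Base using (_∷_; here; there)
open import Data.Product using (∃; ∃-syntax; _×_; _,_; proj₂)
import Data.Sum
open import Data.Sum using (_⊎_; inj₁; inj₂; [_,_]′)
open import Data.Empty using (⊥; ⊥-elim)
open import Relation.Binary.Definitions using (Symmetric; tri<; tri≈; tri>)
open import Relation.Binary.PropositionalEquality
open import Relation.Nullary using (¬_; Dec; yes; no)
open import Relation.Nullary.Decidable using (_⊎-dec_)
open import Relation.Unary using (Decidable)
open import Function using (_∘_)

Least : (ℕ → Set) → ℕ → Set
Least P k = P k × (∀ j → j < k → ¬ P j)

module _ {P : ℕ → Set} (P? : Decidable P) where

  least-from : ∀ i → (∀ j → j < i → ¬ P j) → ∀ d → P (d + i) → ∃ (Least P)
  least-from i below d p with P? i
  ... | yes pᵢ = i , pᵢ , below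
  least-from i below zero    p | no ¬pᵢ = ⊥-elim (¬pᵢ p)
  least-from i below (suc d) p | no ¬pᵢ =
    least-from (suc i) below′ d (subst P (sym (+-suc d i)) p)
    where
    below′ : ∀ j → j < suc i → ¬ P j
    below′ j j<1+i with m<1+n⇒m<n∨m≡n j<1+i
    ... | inj₁ j<i  = below j j<i
    ... | inj₂ refl = ¬pᵢ

  least : ∀ {m} → P m → ∃ (Least P)
  least {m} p = least-from 0 (λ _ ()) m (subst P (sym (+-identityʳ m)) p)

x∈p─q⇒x∉q : ∀ {n} {p q : Subset n} {x} → x ∈ p ─ q → x ∉ q
x∈p─q⇒x∉q {p = _ ∷ p} {inside  ∷ q} {Fin.zero}  ()
x∈p─q⇒x∉q {p = _ ∷ p} {outside ∷ q} {Fin.zero}  _         ()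
x∈p─q⇒x∉q {p = _ ∷ p} {_ ∷ q}       {Fin.suc x} (there x∈p─q) (there x∈q) = x∈p─q⇒x∉q x∈p─q x∈q

∣p∣≡1+∣p-x∣ : ∀ {n} {p : Subset n} {x} → x ∈ p → ∣ p ∣ ≡ suc ∣ p - x ∣
∣p∣≡1+∣p-x∣ {p = inside  ∷ p} here       = cong (suc ∘ ∣_∣) (sym (p─⊥≡p p))
∣p∣≡1+∣p-x∣ {p = inside  ∷ p} (there x∈p) = cong suc (∣p∣≡1+∣p-x∣ x∈p)
∣p∣≡1+∣p-x∣ {p = outside ∷ p} (there x∈p) = ∣p∣≡1+∣p-x∣ x∈p

module _ {n : ℕ} where

  x∈p-y⁻ : ∀ {p : Subset n} {x y} → x ∈ p - y → x ∈ p × x ≢ y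
  x∈p-y⁻ {p} {x} {y} x∈p-y = p─q⊆p p ⁅ y ⁆ x∈p-y , λ { refl → x∈p─q⇒x∉q x∈p-y (x∈⁅x⁆ y) }

  x∈p⇒∣p∣>0 : ∀ {p : Subset n} {x} → x ∈ p → 0 < ∣ p ∣
  x∈p⇒∣p∣>0 x∈p rewrite ∣p∣≡1+∣p-x∣ x∈p = s≤s z≤n

  ∣p∣>k⇒member : ∀ {p : Subset n} {k} → suc k ≤ ∣ p ∣ → ∃[ x ] (x ∈ p × k ≤ ∣ p - x ∣)
  ∣p∣>k⇒member {p} k<∣p∣ with nonempty? p
  ... | yes (x , x∈p) = x , x∈p , s≤s⁻¹ (subst (_ ≤_) (∣p∣≡1+∣p-x∣ x∈p) k<∣p∣)
  ... | no ∄x with subst (suc _ ≤_) (trans (cong ∣_∣ (Empty-unique ∄x)) (∣⊥∣≡0 n)) k<∣p∣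
  ...   | ()

  two-members⇒∣p∣≥2 : ∀ {p : Subset n} {x y} → x ∈ p → y ∈ p → x ≢ y → 2 ≤ ∣ p ∣
  two-members⇒∣p∣≥2 x∈p y∈p x≢y rewrite ∣p∣≡1+∣p-x∣ x∈p =
    s≤s (x∈p⇒∣p∣>0 (x∈p∧x≢y⇒x∈p-y y∈p (x≢y ∘ sym)))

  ∣p∣≥2⇒two-members : ∀ {p : Subset n} → 2 ≤ ∣ p ∣ → ∃[ x ] ∃[ y ] (x ∈ p × y ∈ p × x ≢ y)
  ∣p∣≥2⇒two-members 2≤∣p∣ with ∣p∣>k⇒member 2≤∣p∣
  ... | x , x∈p , 1≤∣p-x∣ with ∣p∣>k⇒member 1≤∣p-x∣
  ... | y , y∈p-x , _ = let y∈p , y≢x = x∈p-y⁻ y∈p-x in x , y , x∈p , y∈p , y≢x ∘ sym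

  ∣p∣≥3⇒three-members : ∀ {p : Subset n} → 3 ≤ ∣ p ∣ →
                        ∃[ x ] ∃[ y ] ∃[ z ] (x ∈ p × y ∈ p × z ∈ p × x ≢ y × x ≢ z × y ≢ z)
  ∣p∣≥3⇒three-members 3≤∣p∣ with ∣p∣>k⇒member 3≤∣p∣
  ... | x , x∈p , 2≤∣p-x∣ with ∣p∣≥2⇒two-members 2≤∣p-x∣
  ... | y , z , y∈p-x , z∈p-x , y≢z =
    let y∈p , y≢x = x∈p-y⁻ y∈p-x ; z∈p , z≢x = x∈p-y⁻ z∈p-x
    in x , y , z , x∈p , y∈p , z∈p , y≢x ∘ sym , z≢x ∘ sym , y≢z

  ∈-pairˡ : ∀ (a b : Fin n) → a ∈ ⁅ a ⁆ ∪ ⁅ b ⁆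
  ∈-pairˡ a b = x∈p∪q⁺ (inj₁ (x∈⁅x⁆ a))

  ∈-pairʳ : ∀ (a b : Fin n) → b ∈ ⁅ a ⁆ ∪ ⁅ b ⁆
  ∈-pairʳ a b = x∈p∪q⁺ (inj₂ (x∈⁅x⁆ b))

  ∈-pair⁻ : ∀ {a b x : Fin n} → x ∈ ⁅ a ⁆ ∪ ⁅ b ⁆ → x ≡ a ⊎ x ≡ b
  ∈-pair⁻ {a} {b} x∈ab = Data.Sum.map (x∈⁅y⁆⇒x≡y a) (x∈⁅y⁆⇒x≡y b) (x∈p∪q⁻ ⁅ a ⁆ ⁅ b ⁆ x∈ab)

  x∈p⇒⁅x⁆⊆p : ∀ {p : Subset n} {x} → x ∈ p → ⁅ x ⁆ ⊆ p
  x∈p⇒⁅x⁆⊆p {p} {x} x∈p y∈⁅x⁆ = subst (_∈ p) (sym (x∈⁅y⁆⇒x≡y x y∈⁅x⁆)) x∈p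

  p⊆r∧q⊆r⇒p∪q⊆r : ∀ {p q r : Subset n} → p ⊆ r → q ⊆ r → p ∪ q ⊆ r
  p⊆r∧q⊆r⇒p∪q⊆r {p} {q} p⊆r q⊆r x∈p∪q = [ p⊆r , q⊆r ]′ (x∈p∪q⁻ p q x∈p∪q)

  pair⊆ : ∀ {r : Subset n} {a b} → a ∈ r → b ∈ r → ⁅ a ⁆ ∪ ⁅ b ⁆ ⊆ r
  pair⊆ a∈r b∈r = p⊆r∧q⊆r⇒p∪q⊆r (x∈p⇒⁅x⁆⊆p a∈r) (x∈p⇒⁅x⁆⊆p b∈r)

  pair⊂ : ∀ {r : Subset n} {a b c} → a ∈ r → b ∈ r → c ∈ r → c ≢ a → c ≢ b → ⁅ a ⁆ ∪ ⁅ b ⁆ ⊂ r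
  pair⊂ a∈r b∈r c∈r c≢a c≢b = pair⊆ a∈r b∈r , _ , c∈r , [ c≢a , c≢b ]′ ∘ ∈-pair⁻

-- Walks and distances in an arbitrary graph

module _ {n : ℕ} {G : Graph n} where

  snoc : ∀ {u v w k} → Walk G u v k → G v w → Walk G u w (suc k)
  snoc here       e = step e here
  snoc (step a p) e = step a (snoc p e)

  reverse : Symmetric G → ∀ {u w k} → Walk G u w k → Walk G w u k
  reverse sym-G here       = here
  reverse sym-G (step e p) = snoc (reverse sym-G p) (sym-G e)

  dist-unique : ∀ {u h a b} → Dist G u h a → Dist G u h b → a ≡ b
  dist-unique {a = a} {b} (p , a-min) (q , b-min) with <-cmp a b
  ... | tri< a<b _ _ = ⊥-elim (b-min a a<b p)
  ... | tri≈ _ a≡b _ = a≡b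
  ... | tri> _ _ b<a = ⊥-elim (a-min b b<a q)

  adjacent⇒dist-one : ∀ {u v} → G u v → u ≢ v → Dist G u v 1
  adjacent⇒dist-one e u≢v = step e here , λ { zero _ here → u≢v refl ; (suc _) (s≤s ()) _ }

  ResIndep-⊆ : ∀ {A B} → A ⊆ B → ResIndep G B → ResIndep G A
  ResIndep-⊆ A⊆B (R , minimal-R , B⊆R) = R , minimal-R , B⊆R ∘ A⊆B

  resolving-escapes : ∀ {S u w c k} → Resolving G S → u ≢ w → Dist G u c k → Dist G w c k →
                      ∃[ y ] (y ∈ S × y ≢ c)
  resolving-escapes {c = c} res u≢w du dw with res _ _ u≢w
  ... | h , h∈S , a , b , da , db , a≢b with h ≟ᶠ c
  ... | yes refl = ⊥-elim (a≢b (trans (dist-unique da du) (dist-unique dw db)))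
  ... | no h≢c   = h , h∈S , h≢c

-- The cycle C n: distances via arithmetic modulo n

module _ {n : ℕ} .{{_ : NonZero n}} where

  infix 4 _≋_ _≋?_
  _≋_ : ℕ → ℕ → Set
  a ≋ b = a % n ≡ b % n

  +-congʳ-≋ : ∀ {a b} c → a ≋ b → a + c ≋ b + c
  +-congʳ-≋ {a} {b} c a≋b = begin
    (a + c) % n           ≡⟨ %-distribˡ-+ a c n ⟩
    (a % n + c % n) % n   ≡⟨ cong (λ x → (x + c % n) % n) a≋b ⟩
    (b % n + c % n) % n   ≡⟨ %-distribˡ-+ b c n ⟨
    (b + c) % n           ∎
    where open ≡-Reasoning

  +-congˡ-≋ : ∀ {a b} c → a ≋ b → c + a ≋ c + b
  +-congˡ-≋ {a} {b} c a≋b = begin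
    (c + a) % n   ≡⟨ cong (_% n) (+-comm c a) ⟩
    (a + c) % n   ≡⟨ +-congʳ-≋ c a≋b ⟩
    (b + c) % n   ≡⟨ cong (_% n) (+-comm b c) ⟩
    (c + b) % n   ∎
    where open ≡-Reasoning

  -- Adding c·(n − 1) to both sides of a + c ≋ b + c turns c into the multiple c·n.
  +-cancelʳ-≋ : ∀ {a b} c → a + c ≋ b + c → a ≋ b
  +-cancelʳ-≋ {a} {b} c a+c≋b+c = begin
    a % n                     ≡⟨ [m+kn]%n≡m%n a c n ⟨
    (a + c * n) % n           ≡⟨ cong (_% n) (unfold a) ⟩
    (a + c + c * pred n) % n  ≡⟨ +-congʳ-≋ (c * pred n) a+c≋b+c ⟩
    (b + c + c * pred n) % n  ≡⟨ cong (_% n) (unfold b) ⟨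
    (b + c * n) % n           ≡⟨ [m+kn]%n≡m%n b c n ⟩
    b % n                     ∎
    where
    open ≡-Reasoning
    unfold : ∀ x → x + c * n ≡ x + c + c * pred n
    unfold x = begin
      x + c * n                ≡⟨ cong (λ m → x + c * m) (suc-pred n) ⟨
      x + c * suc (pred n)     ≡⟨ cong (x +_) (*-suc c (pred n)) ⟩
      x + (c + c * pred n)     ≡⟨ +-assoc x c (c * pred n) ⟨
      x + c + c * pred n       ∎

  +-cancelˡ-≋ : ∀ c {a b} → c + a ≋ c + b → a ≋ b
  +-cancelˡ-≋ c {a} {b} c+a≋c+b =
    +-cancelʳ-≋ c (trans (cong (_% n) (+-comm a c)) (trans c+a≋c+b (cong (_% n) (+-comm c b))))

  +-cong-≋ : ∀ {a b c d} → a ≋ b → c ≋ d → a + c ≋ b + d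
  +-cong-≋ {b = b} {c} a≋b c≋d = trans (+-congʳ-≋ c a≋b) (+-congˡ-≋ b c≋d)

  ≋⇒≡ : ∀ {a b} → a < n → b < n → a ≋ b → a ≡ b
  ≋⇒≡ {a} {b} a<n b<n a≋b = trans (sym (m<n⇒m%n≡m a<n)) (trans a≋b (m<n⇒m%n≡m b<n))

  _≋?_ : ∀ a b → Dec (a ≋ b)
  a ≋? b = a % n ≟ b % n

  private
    0<n : 0 < n
    0<n = >-nonZero⁻¹ n

  n≋0 : n ≋ 0
  n≋0 = trans (n%n≡0 n) (sym (m<n⇒m%n≡m 0<n))

  toℕ-mod : ∀ a → toℕ (a mod n) ≋ a
  toℕ-mod a = trans (cong (_% n) (toℕ-fromℕ< (m%n<n a n))) (m%n%n≡m%n a n)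

  -- k steps in one fixed direction lead from u to h; d(u, h) turns out to be the least such k.
  Around : ℕ → ℕ → ℕ → Set
  Around u h k = k + u ≋ h ⊎ k + h ≋ u

  around? : ∀ u h k → Dec (Around u h k)
  around? u h k = (k + u ≋? h) ⊎-dec (k + h ≋? u)

  cycle-sym : Symmetric (C n)
  cycle-sym (inj₁ e)                = inj₂ (inj₁ e)
  cycle-sym (inj₂ (inj₁ e))         = inj₁ e
  cycle-sym (inj₂ (inj₂ (inj₁ e)))  = inj₂ (inj₂ (inj₂ e))
  cycle-sym (inj₂ (inj₂ (inj₂ e)))  = inj₂ (inj₂ (inj₁ e))

  adjacent⇒around-one : ∀ {u v : Fin n} → C n u v → Around (toℕ u) (toℕ v) 1
  adjacent⇒around-one (inj₁ e)                          = inj₁ (cong (_% n) e)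
  adjacent⇒around-one (inj₂ (inj₁ e))                   = inj₂ (cong (_% n) e)
  adjacent⇒around-one (inj₂ (inj₂ (inj₁ (e , v≡0))))    = inj₁ (trans (cong (_% n) e) (trans n≋0 (cong (_% n) (sym v≡0))))
  adjacent⇒around-one (inj₂ (inj₂ (inj₂ (e , u≡0))))    = inj₂ (trans (cong (_% n) e) (trans n≋0 (cong (_% n) (sym u≡0))))

  suc≋⇒adjacent : ∀ {u v : Fin n} → 1 + toℕ u ≋ toℕ v → C n u v
  suc≋⇒adjacent {u} {v} e with m≤n⇒m<n∨m≡n (toℕ<n u)
  ... | inj₁ 1+u<n = inj₁ (≋⇒≡ 1+u<n (toℕ<n v) e)
  ... | inj₂ 1+u≡n = inj₂ (inj₂ (inj₁ (1+u≡n , ≋⇒≡ (toℕ<n v) 0<n (trans (sym e) (trans (cong (_% n) 1+u≡n) n≋0)))))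

  toℕ-≋-injective : ∀ {u w : Fin n} → toℕ u ≋ toℕ w → u ≡ w
  toℕ-≋-injective {u} {w} = toℕ-injective ∘ ≋⇒≡ (toℕ<n u) (toℕ<n w)

  forward-walk : ∀ k {u h : Fin n} → k + toℕ u ≋ toℕ h → Walk (C n) u h k
  forward-walk zero e with toℕ-≋-injective e
  ... | refl = here
  forward-walk (suc k) {u} {h} e =
    step (suc≋⇒adjacent (sym (toℕ-mod (suc (toℕ u))))) (forward-walk k rest)
    where
    rest : k + toℕ (suc (toℕ u) mod n) ≋ toℕ h
    rest = trans (+-congˡ-≋ k (toℕ-mod (suc (toℕ u)))) (trans (cong (_% n) (+-suc k (toℕ u))) e)

  around⇒walk : ∀ {u h : Fin n} {k} → Around (toℕ u) (toℕ h) k → Walk (C n) u h k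
  around⇒walk {k = k} (inj₁ e) = forward-walk k e
  around⇒walk {k = k} (inj₂ e) = reverse cycle-sym (forward-walk k e)

  around-step : ∀ {u v h k} → Around u v 1 → Around v h k → ∃[ k′ ] (k′ ≤ suc k × Around u h k′)
  around-step {u} {k = k} (inj₁ e) (inj₁ p) =
    suc k , ≤-refl , inj₁ (trans (cong (_% n) (sym (+-suc k u))) (trans (+-congˡ-≋ k e) p))
  around-step {k = zero}  (inj₁ e) (inj₂ p) = 1 , ≤-refl , inj₁ (trans e (sym p))
  around-step {k = suc j} (inj₁ e) (inj₂ p) = j , m≤n⇒m≤1+n (n≤1+n j) , inj₂ (+-cancelˡ-≋ 1 (trans p (sym e)))
  around-step {k = k}     (inj₂ e) (inj₂ p) = suc k , ≤-refl , inj₂ (trans (+-congˡ-≋ 1 p) e)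
  around-step {k = zero}  (inj₂ e) (inj₁ p) = 1 , ≤-refl , inj₂ (trans (+-congˡ-≋ 1 (sym p)) e)
  around-step {v = v} {k = suc j} (inj₂ e) (inj₁ p) =
    j , m≤n⇒m≤1+n (n≤1+n j) , inj₁ (trans (+-congˡ-≋ j (sym e)) (trans (cong (_% n) (+-suc j v)) p))

  walk⇒around≤ : ∀ {u h : Fin n} {m} → Walk (C n) u h m → ∃[ k ] (k ≤ m × Around (toℕ u) (toℕ h) k)
  walk⇒around≤ here = 0 , z≤n , inj₁ refl
  walk⇒around≤ (step e p) with walk⇒around≤ p
  ... | k , k≤m , around with around-step (adjacent⇒around-one e) around
  ... | k′ , k′≤1+k , around′ = k′ , ≤-trans k′≤1+k (s≤s k≤m) , around′

  around-exists : ∀ u h → ∃ (Around u h)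
  around-exists u h with ≤-total u h
  ... | inj₁ u≤h = h ∸ u , inj₁ (cong (_% n) (m∸n+n≡m u≤h))
  ... | inj₂ h≤u = u ∸ h , inj₂ (cong (_% n) (m∸n+n≡m h≤u))

  dist-exists : ∀ (u h : Fin n) → ∃[ k ] Dist (C n) u h k
  dist-exists u h with least (around? (toℕ u) (toℕ h)) (proj₂ (around-exists (toℕ u) (toℕ h)))
  ... | k , around , below = k , around⇒walk around , shorter
    where
    shorter : ∀ j → j < k → ¬ Walk (C n) u h j
    shorter j j<k p with walk⇒around≤ p
    ... | j′ , j′≤j , around′ = below j′ (≤-<-trans j′≤j j<k) around′

  dist⇒around : ∀ {u h : Fin n} {k} → Dist (C n) u h k → Around (toℕ u) (toℕ h) k
  dist⇒around (p , minimal) with walk⇒around≤ p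
  ... | k′ , k′≤k , around with m≤n⇒m<n∨m≡n k′≤k
  ... | inj₁ k′<k = ⊥-elim (minimal k′ k′<k (around⇒walk around))
  ... | inj₂ refl = around

  mirrored : ∀ {x y h} k → k + x ≋ h → k + h ≋ y → x + y ≋ h + h
  mirrored {x} {y} {h} k x→h h→y = begin
    (x + y) % n         ≡⟨ +-congˡ-≋ x h→y ⟨
    (x + (k + h)) % n   ≡⟨ cong (_% n) (+-assoc x k h) ⟨
    (x + k + h) % n     ≡⟨ +-congʳ-≋ h (trans (cong (_% n) (+-comm x k)) x→h) ⟩
    (h + h) % n         ∎
    where open ≡-Reasoning

  equidistant⇒mirrored : ∀ {u w h : Fin n} {k} → Dist (C n) u h k → Dist (C n) w h k →
                         u ≡ w ⊎ toℕ u + toℕ w ≋ toℕ h + toℕ h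
  equidistant⇒mirrored {u} {w} {h} {k} du dw with dist⇒around du | dist⇒around dw
  ... | inj₁ p | inj₁ q = inj₁ (toℕ-≋-injective (+-cancelˡ-≋ k (trans p (sym q))))
  ... | inj₂ p | inj₂ q = inj₁ (toℕ-≋-injective (trans (sym p) q))
  ... | inj₁ p | inj₂ q = inj₂ (mirrored k p q)
  ... | inj₂ p | inj₁ q = inj₂ (trans (cong (_% n) (+-comm (toℕ u) (toℕ w))) (mirrored k q p))

  separates-or-mirrored : ∀ {u w : Fin n} h → u ≢ w →
    (∃[ a ] ∃[ b ] (Dist (C n) u h a × Dist (C n) w h b × a ≢ b)) ⊎ toℕ u + toℕ w ≋ toℕ h + toℕ h
  separates-or-mirrored {u} {w} h u≢w with dist-exists u h | dist-exists w h
  ... | a , du | b , dw with a ≟ b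
  ... | no a≢b = inj₁ (a , b , du , dw , a≢b)
  ... | yes refl with equidistant⇒mirrored du dw
  ...   | inj₁ u≡w   = ⊥-elim (u≢w u≡w)
  ...   | inj₂ u+w≋2h = inj₂ u+w≋2h

  -- Reflexive: every vertex counts as antipodal to itself.
  Antipodal : Fin n → Fin n → Set
  Antipodal a b = toℕ a + toℕ a ≋ toℕ b + toℕ b

  antipodal? : ∀ a b → Dec (Antipodal a b)
  antipodal? a b = toℕ a + toℕ a ≋? toℕ b + toℕ b

  non-antipodal⇒resolving : ∀ {a b : Fin n} → ¬ Antipodal a b → Resolving (C n) (⁅ a ⁆ ∪ ⁅ b ⁆)
  non-antipodal⇒resolving {a} {b} ¬a⇔b u w u≢w with separates-or-mirrored a u≢w | separates-or-mirrored b u≢w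
  ... | inj₁ by-a | _         = a , ∈-pairˡ a b , by-a
  ... | inj₂ _    | inj₁ by-b = b , ∈-pairʳ a b , by-b
  ... | inj₂ u+w≋2a | inj₂ u+w≋2b = ⊥-elim (¬a⇔b (trans (sym u+w≋2a) u+w≋2b))

  below-2n : ∀ {x} → x < n + n → ∃[ x′ ] (x′ < n × x′ ≋ x × (x ≡ x′ ⊎ x ≡ x′ + n))
  below-2n {x} x<2n with x <? n
  ... | yes x<n = x , x<n , refl , inj₁ refl
  ... | no x≮n  = x ∸ n , +-cancelʳ-< n (x ∸ n) n (subst (_< n + n) (sym x∸n+n≡x) x<2n) ,
                  trans (sym ([m+n]%n≡m%n (x ∸ n) n)) (cong (_% n) x∸n+n≡x) , inj₂ (sym x∸n+n≡x)
    where
    x∸n+n≡x : x ∸ n + n ≡ x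
    x∸n+n≡x = m∸n+n≡m (≮⇒≥ x≮n)

  ≋-below-2n : ∀ {x y} → x < n + n → y < n + n → x ≋ y → x ≡ y ⊎ x ≡ y + n ⊎ y ≡ x + n
  ≋-below-2n x<2n y<2n x≋y with below-2n x<2n | below-2n y<2n
  ... | x′ , x′<n , x′≋x , x-split | y′ , y′<n , y′≋y , y-split
    with ≋⇒≡ x′<n y′<n (trans x′≋x (trans x≋y (sym y′≋y)))
  ...   | refl with x-split | y-split
  ...     | inj₁ refl | inj₁ refl = inj₁ refl
  ...     | inj₂ refl | inj₂ refl = inj₁ refl
  ...     | inj₂ refl | inj₁ refl = inj₂ (inj₁ refl)
  ...     | inj₁ refl | inj₂ refl = inj₂ (inj₂ refl)

  double<n+n : ∀ (x : Fin n) → toℕ x + toℕ x < n + n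
  double<n+n x = +-mono-< (toℕ<n x) (toℕ<n x)

  double-injective : ∀ {x y} → x + x ≡ y + y → x ≡ y
  double-injective {x} {y} e with <-cmp x y
  ... | tri< x<y _ _ = ⊥-elim (<-irrefl e (+-mono-< x<y x<y))
  ... | tri≈ _ x≡y _ = x≡y
  ... | tri> _ _ y<x = ⊥-elim (<-irrefl (sym e) (+-mono-< y<x y<x))

  distinct-antipodes : ∀ {a b : Fin n} → a ≢ b → Antipodal a b →
                       toℕ a + toℕ a ≡ toℕ b + toℕ b + n ⊎ toℕ b + toℕ b ≡ toℕ a + toℕ a + n
  distinct-antipodes {a} {b} a≢b a⇔b with ≋-below-2n (double<n+n a) (double<n+n b) a⇔b
  ... | inj₁ 2a≡2b      = ⊥-elim (a≢b (toℕ-injective (double-injective 2a≡2b)))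
  ... | inj₂ differ-by-n = differ-by-n

  double≢+n+n : ∀ (x y : Fin n) → toℕ x + toℕ x ≢ toℕ y + toℕ y + n + n
  double≢+n+n x y e = <-irrefl e (<-≤-trans (double<n+n x) (+-monoˡ-≤ n (m≤n+m n (toℕ y + toℕ y))))

  antipode-unique : ∀ {a b c : Fin n} → a ≢ b → a ≢ c → Antipodal a b → Antipodal a c → b ≡ c
  antipode-unique {a} {b} {c} a≢b a≢c a⇔b a⇔c with distinct-antipodes a≢b a⇔b | distinct-antipodes a≢c a⇔c
  ... | inj₁ 2a≡2b+n | inj₁ 2a≡2c+n =
    toℕ-injective (double-injective (+-cancelʳ-≡ n _ _ (trans (sym 2a≡2b+n) 2a≡2c+n)))
  ... | inj₂ 2b≡2a+n | inj₂ 2c≡2a+n = toℕ-injective (double-injective (trans 2b≡2a+n (sym 2c≡2a+n)))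
  ... | inj₁ 2a≡2b+n | inj₂ 2c≡2a+n = ⊥-elim (double≢+n+n c b (trans 2c≡2a+n (cong (_+ n) 2a≡2b+n)))
  ... | inj₂ 2b≡2a+n | inj₁ 2a≡2c+n = ⊥-elim (double≢+n+n b c (trans 2b≡2a+n (cong (_+ n) 2a≡2c+n)))

  some-non-antipodal : ∀ {a b c : Fin n} → a ≢ b → a ≢ c → b ≢ c → ¬ Antipodal a b ⊎ ¬ Antipodal a c
  some-non-antipodal {a} {b} {c} a≢b a≢c b≢c with antipodal? a b | antipodal? a c
  ... | no ¬a⇔b | _        = inj₁ ¬a⇔b
  ... | yes _   | no ¬a⇔c  = inj₂ ¬a⇔c
  ... | yes a⇔b | yes a⇔c  = ⊥-elim (b≢c (antipode-unique a≢b a≢c a⇔b a⇔c))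

  no-short-loop : ∀ {k} x → 0 < k → k < n → ¬ (k + x ≋ x)
  no-short-loop {k} x 0<k k<n k+x≋x = <-irrefl (sym (≋⇒≡ k<n 0<n (+-cancelʳ-≋ x k+x≋x))) 0<k

  suc≋⇒≢ : 1 < n → ∀ {x y : Fin n} → 1 + toℕ x ≋ toℕ y → x ≢ y
  suc≋⇒≢ 1<n {x} x→y refl = no-short-loop (toℕ x) (s≤s z≤n) 1<n x→y

-- Resolving sets of C n for n ≥ 3

module _ {n : ℕ} .{{_ : NonZero n}} (3≤n : 3 ≤ n) where

  two-neighbours : ∀ (c : Fin n) → ∃[ u ] ∃[ w ] (u ≢ w × Dist (C n) u c 1 × Dist (C n) w c 1)
  two-neighbours c = u , w , u≢w ,
    adjacent⇒dist-one (cycle-sym (suc≋⇒adjacent c→u)) (suc≋⇒≢ 1<n c→u ∘ sym) ,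
    adjacent⇒dist-one (suc≋⇒adjacent w→c) (suc≋⇒≢ 1<n w→c)
    where
    1<n : 1 < n
    1<n = ≤-trans (s≤s (s≤s z≤n)) 3≤n
    u w : Fin n
    u = suc (toℕ c) mod n
    w = (toℕ c + pred n) mod n
    c→u : 1 + toℕ c ≋ toℕ u
    c→u = sym (toℕ-mod (suc (toℕ c)))
    w→c : 1 + toℕ w ≋ toℕ c
    w→c = begin
      suc (toℕ w) % n               ≡⟨ +-congˡ-≋ 1 (toℕ-mod (toℕ c + pred n)) ⟩
      suc (toℕ c + pred n) % n      ≡⟨ cong (_% n) (+-suc (toℕ c) (pred n)) ⟨
      (toℕ c + suc (pred n)) % n    ≡⟨ cong (λ m → (toℕ c + m) % n) (suc-pred n) ⟩
      (toℕ c + n) % n               ≡⟨ [m+n]%n≡m%n (toℕ c) n ⟩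
      toℕ c % n                     ∎
      where open ≡-Reasoning
    u≢w : u ≢ w
    u≢w u≡w = no-short-loop (toℕ c) (s≤s z≤n) 3≤n
      (trans (+-congˡ-≋ 1 c→u) (trans (cong (λ v → suc (toℕ v) % n) u≡w) w→c))

  resolving-escapes-vertex : ∀ {S} → Resolving (C n) S → ∀ c → ∃[ y ] (y ∈ S × y ≢ c)
  resolving-escapes-vertex res c =
    let u , w , u≢w , du , dw = two-neighbours c in resolving-escapes res u≢w du dw

  resolving-within-pair : ∀ {S a b} → Resolving (C n) S → (∀ {y} → y ∈ S → y ≡ a ⊎ y ≡ b) → a ∈ S
  resolving-within-pair {b = b} res S⊆ab with resolving-escapes-vertex res b
  ... | y , y∈S , y≢b with S⊆ab y∈S
  ...   | inj₁ refl = y∈S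
  ...   | inj₂ y≡b  = ⊥-elim (y≢b y≡b)

  non-antipodal⇒minimal-resolving : ∀ {a b} → ¬ Antipodal a b → MinimalResolving (C n) (⁅ a ⁆ ∪ ⁅ b ⁆)
  non-antipodal⇒minimal-resolving {a} {b} ¬a⇔b = non-antipodal⇒resolving ¬a⇔b , proper-subsets
    where
    proper-subsets : ∀ S → S ⊂ ⁅ a ⁆ ∪ ⁅ b ⁆ → ¬ Resolving (C n) S
    proper-subsets S (S⊆ab , z , z∈ab , z∉S) res with ∈-pair⁻ z∈ab
    ... | inj₁ refl = z∉S (resolving-within-pair res (∈-pair⁻ ∘ S⊆ab))
    ... | inj₂ refl = z∉S (resolving-within-pair res (Data.Sum.swap ∘ ∈-pair⁻ ∘ S⊆ab))

  minimal-resolving-no-three : ∀ {R x y z} → MinimalResolving (C n) R → x ∈ R → y ∈ R → z ∈ R →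
                               x ≢ y → x ≢ z → y ≢ z → ⊥
  minimal-resolving-no-three (_ , minimal) x∈R y∈R z∈R x≢y x≢z y≢z with some-non-antipodal x≢y x≢z y≢z
  ... | inj₁ ¬x⇔y = minimal _ (pair⊂ x∈R y∈R z∈R (x≢z ∘ sym) (y≢z ∘ sym)) (non-antipodal⇒resolving ¬x⇔y)
  ... | inj₂ ¬x⇔z = minimal _ (pair⊂ x∈R z∈R y∈R (x≢y ∘ sym) y≢z) (non-antipodal⇒resolving ¬x⇔z)

  ResIndep-∣∣≤2 : ∀ {B} → ResIndep (C n) B → ∣ B ∣ ≤ 2
  ResIndep-∣∣≤2 (R , minimal-R , B⊆R) = ≮⇒≥ λ 2<∣B∣ →
    let x , y , z , x∈B , y∈B , z∈B , x≢y , x≢z , y≢z = ∣p∣≥3⇒three-members 2<∣B∣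
    in minimal-resolving-no-three minimal-R (B⊆R x∈B) (B⊆R y∈B) (B⊆R z∈B) x≢y x≢z y≢z

  below-independent⇒⊆⁅a⁆ : ∀ {A B : Subset n} {a} → ResIndep (C n) B → ∣ A ∣ < ∣ B ∣ → a ∈ A → A ⊆ ⁅ a ⁆
  below-independent⇒⊆⁅a⁆ {a = a} indep-B ∣A∣<∣B∣ a∈A {y} y∈A with y ≟ᶠ a
  ... | yes refl = x∈⁅x⁆ a
  ... | no y≢a   = ⊥-elim (≤⇒≯ (ResIndep-∣∣≤2 indep-B) (≤-<-trans (two-members⇒∣p∣≥2 a∈A y∈A (y≢a ∘ sym)) ∣A∣<∣B∣))

  pair-extends : ∀ {R B a b₁ b₂} → MinimalResolving (C n) R → B ⊆ R → b₁ ∈ B → b₂ ∈ B → b₁ ≢ b₂ →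
                 ∃[ x ] (x ∈ B × x ≢ a × ResIndep (C n) (⁅ a ⁆ ∪ ⁅ x ⁆))
  pair-extends {a = a} {b₁} {b₂} minimal-R B⊆R b₁∈B b₂∈B b₁≢b₂ with a ≟ᶠ b₁ | a ≟ᶠ b₂
  ... | yes refl | _        = b₂ , b₂∈B , b₁≢b₂ ∘ sym , _ , minimal-R , pair⊆ (B⊆R b₁∈B) (B⊆R b₂∈B)
  ... | no _     | yes refl = b₁ , b₁∈B , b₁≢b₂ , _ , minimal-R , pair⊆ (B⊆R b₂∈B) (B⊆R b₁∈B)
  ... | no a≢b₁  | no a≢b₂ with some-non-antipodal a≢b₁ a≢b₂ b₁≢b₂
  ...   | inj₁ ¬a⇔b₁ = b₁ , b₁∈B , a≢b₁ ∘ sym , _ , non-antipodal⇒minimal-resolving ¬a⇔b₁ , ⊆-refl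
  ...   | inj₂ ¬a⇔b₂ = b₂ , b₂∈B , a≢b₂ ∘ sym , _ , non-antipodal⇒minimal-resolving ¬a⇔b₂ , ⊆-refl

  exchange : ∀ {A B} → ResIndep (C n) A → ResIndep (C n) B → ∣ A ∣ < ∣ B ∣ →
             ∃[ x ] (x ∈ B × x ∉ A × ResIndep (C n) (A ∪ ⁅ x ⁆))
  exchange {A} {B} _ indep-B@(R , minimal-R , B⊆R) ∣A∣<∣B∣ with nonempty? A
  ... | no ∄a =
    let x , x∈B , _ = ∣p∣>k⇒member ∣A∣<∣B∣
    in x , x∈B , (λ x∈A → ∄a (x , x∈A)) , R , minimal-R ,
       p⊆r∧q⊆r⇒p∪q⊆r (λ y∈A → ⊥-elim (∄a (_ , y∈A))) (x∈p⇒⁅x⁆⊆p (B⊆R x∈B))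
  ... | yes (a , a∈A) =
    let A⊆a = below-independent⇒⊆⁅a⁆ indep-B ∣A∣<∣B∣ a∈A
        b₁ , b₂ , b₁∈B , b₂∈B , b₁≢b₂ = ∣p∣≥2⇒two-members (≤-trans (s≤s (x∈p⇒∣p∣>0 a∈A)) ∣A∣<∣B∣)
        x , x∈B , x≢a , indep-ax = pair-extends minimal-R B⊆R b₁∈B b₂∈B b₁≢b₂
    in x , x∈B , x≢a ∘ x∈⁅y⁆⇒x≡y a ∘ A⊆a ,
       ResIndep-⊆ (p⊆r∧q⊆r⇒p∪q⊆r (p⊆p∪q ⁅ x ⁆ ∘ A⊆a) (q⊆p∪q ⁅ a ⁆ ⁅ x ⁆)) indep-ax

  zero-one-not-antipodal : ¬ Antipodal (0 mod n) (1 mod n)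
  zero-one-not-antipodal 0⇔1 = no-short-loop 0 (s≤s z≤n) 3≤n
    (trans (sym (+-cong-≋ (toℕ-mod 1) (toℕ-mod 1))) (trans (sym 0⇔1) (+-cong-≋ (toℕ-mod 0) (toℕ-mod 0))))

  cycle-ResIndep-isMatroid : IsMatroid (ResIndep (C n))
  cycle-ResIndep-isMatroid = record
    { empty-indep = _ , non-antipodal⇒minimal-resolving {0 mod n} {1 mod n} zero-one-not-antipodal , ⊥⊆
    ; down-closed = ResIndep-⊆
    ; exchange    = exchange
    }

theorem6 : (n : ℕ) → n ≥ 3 → IsMatroid (ResIndep (C n))
theorem6 n@(suc _) 3≤n = cycle-ResIndep-isMatroid 3≤n
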